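{- Define elements $\mathfrak A_n\in\mathbf{WSym}$ by $\mathfrak A_0=1$ and $\mathfrak A_{n+1}=\mathfrak A_n\,\Phi_{\{\{1\}\}}+\partial(\mathfrak A_n)$ for $n\ge0$. Then for every $n\ge0$, $$\mathfrak A_n=\sum_{\pi}\Phi_\pi,$$ where the sum is over all set partitions $\pi$ of $\{1,\dots,n\}$.
   Context: $\mathbf{WSym}$ is the algebra with basis $(\Phi_\pi)$ indexed by set partitions $\pi$ of $\{1,\dots,n\}$, $n\ge0$ ($\Phi_\emptyset=1$), with product $\Phi_\pi\Phi_{\pi'}=\Phi_{\pi\cup\pi'[n]}$ when $\pi$ is a partition of $\{1,\dots,n\}$, where $\pi'[n]$ adds $n$ to each element of each block of $\pi'$. $\partial:\mathbf{WSym}\to\mathbf{WSym}$ is the linear map with $\partial(1)=0$ and, for a set partition $\pi=\{\pi_1,\dots,\pi_k\}$ of $\{1,\dots,n\}$, $n\ge1$, $\partial(\Phi_\pi)=\sum_{i=1}^k\Phi_{(\pi\setminus\{\pi_i\})\cup\{\pi_i\cup\{n+1\}\}}$. -}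

module Defs where

open import Data.Nat using (ℕ; zero; suc; _+_; _<_)
open import Data.Integer using (ℤ; +_) renaming (_+_ to _+ℤ_; _*_ to _*ℤ_)
open import Data.Product using (_×_; _,_; proj₁; proj₂)
open import Data.Empty using (⊥)
open import Data.List using (List; []; _∷_; _++_; map; concat; length; upTo; concatMap)
open import Data.List.Properties using (≡-dec)
open import Data.List.Relation.Unary.All using (All)
open import Data.List.Relation.Unary.Linked using (Linked)
open import Data.List.Relation.Binary.Permutation.Propositional using (_↭_)
open import Relation.Binary.PropositionalEquality using (_≡_; _≢_)
open import Relation.Nullary using (yes; no)
import Data.Nat as ℕ

-- A set partition is written as its list of blocks; each block is a list of
-- elements of {1,…,n}.  Canonical representative: each block listed in
-- increasing order, blocks listed by increasing minimum.
Block : Set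
Block = List ℕ

Blocks : Set
Blocks = List Block

firstLt : Block → Block → Set
firstLt (x ∷ _) (y ∷ _) = x < y
firstLt _ _ = ⊥

IsSetPartition : ℕ → Blocks → Set
IsSetPartition n σ =
  All (λ b → b ≢ []) σ ×
  All (Linked _<_) σ ×
  Linked firstLt σ ×
  (concat σ ↭ map suc (upTo n))

-- the n with π a partition of {1,…,n}
size : Blocks → ℕ
size π = length (concat π)

shift : ℕ → Blocks → Blocks
shift n = map (map (λ k → n + k))

addToOneBlock : ℕ → Blocks → List Blocks
addToOneBlock m [] = []
addToOneBlock m (b ∷ bs) = ((b ++ (m ∷ [])) ∷ bs) ∷ map (b ∷_) (addToOneBlock m bs)

-- Elements of WSym (over ℤ): finite formal ℤ-linear combinations of the Φ_π
WSym : Set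
WSym = List (ℤ × Blocks)

coeff : WSym → Blocks → ℤ
coeff [] σ = + 0
coeff ((a , π) ∷ xs) σ with ≡-dec (≡-dec ℕ._≟_) π σ
... | yes _ = a +ℤ coeff xs σ
... | no  _ = coeff xs σ

one : WSym
one = (+ 1 , []) ∷ []

Φ₁ : WSym
Φ₁ = (+ 1 , ((1 ∷ []) ∷ [])) ∷ []

-- bilinear product: Φ_π Φ_π' = Φ_{π ∪ π'[n]}
_·_ : WSym → WSym → WSym
x · y = concatMap (λ t → map (λ u → (proj₁ t *ℤ proj₁ u , proj₂ t ++ shift (size (proj₂ t)) (proj₂ u))) y) x

∂ : WSym → WSym
∂ = concatMap (λ t → map (λ π' → (proj₁ t , π')) (addToOneBlock (suc (size (proj₂ t))) (proj₂ t)))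

𝔄 : ℕ → WSym
𝔄 zero = one
𝔄 (suc n) = (𝔄 n · Φ₁) ++ ∂ (𝔄 n)

-- Read on basis elements, the recursion says that every partition of {1,…,n}
-- contributes the partitions of {1,…,n+1} obtained by putting n+1 either into
-- a new singleton block (the product with Φ_{{1}}) or at the end of one of its
-- blocks (the derivation ∂).  Deleting n+1 inverts both operations, so every
-- partition of {1,…,n+1} arises exactly once: 𝔄 n is the sum of a duplicate-free
-- enumeration of the set partitions of {1,…,n}, each with coefficient 1.
module Submission where

open import Defs
open import Data.Nat using (ℕ; zero; suc; _+_; _<_; _≤_; s≤s)
import Data.Nat as ℕ
open import Data.Nat.Properties using (+-comm; <⇒≱; 1+n≰n; n<1+n)
open import Data.Integer using (+_) renaming (_+_ to _+ℤ_)
open import Data.Product using (_×_; _,_; proj₁; ∃)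
open import Data.Sum using (_⊎_; inj₁; inj₂)
open import Data.Empty using (⊥-elim)
open import Function using (_∘_)
open import Data.List
  using (List; []; _∷_; _++_; _∷ʳ_; [_]; map; concat; concatMap; upTo)
open import Data.List.Properties
  using ( ≡-dec; ++-assoc; ++-conicalˡ; ++-identityʳ; ∷-injectiveˡ; ∷-injectiveʳ; ∷ʳ-injectiveˡ
        ; map-++; map-cong-local; upTo-∷ʳ; length-map; length-upTo)
open import Data.List.Relation.Unary.All as All using (All; []; _∷_)
open import Data.List.Relation.Unary.Any using (here; there)
open import Data.List.Relation.Unary.Linked as Linked using (Linked; []; [-]; _∷_)
open import Data.List.Relation.Unary.Unique.Propositional using (Unique; []; _∷_)
import Data.List.Relation.Unary.Unique.Propositional.Properties as Unique
open import Data.List.Membership.Propositional using (_∈_; _∉_; find; lose)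
open import Data.List.Membership.Propositional.Properties
  using (∈-map⁺; ∈-map⁻; ∈-++⁺ˡ; ∈-++⁺ʳ; ∈-++⁻; ∈-concatMap⁺; ∈-concatMap⁻; ∈-upTo⁺; ∈-upTo⁻)
open import Data.List.Relation.Binary.Permutation.Propositional
  using (_↭_; ↭-sym; ↭-reflexive; module PermutationReasoning)
open import Data.List.Relation.Binary.Permutation.Propositional.Properties
  using (∈-resp-↭; ↭-length; ↭-empty-inv; ++⁺ˡ; ++⁺ʳ; ++-comm; drop-mid)
open import Relation.Nullary using (¬_; yes; no)
open import Relation.Binary.PropositionalEquality
  using (_≡_; _≢_; refl; sym; trans; cong; cong₂; subst; module ≡-Reasoning)

private
  variable
    m n : ℕ
    τ τ′ σ σ′ : Blocks

∷ʳ≢[] : ∀ {A : Set} (xs : List A) {x} → xs ∷ʳ x ≢ []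
∷ʳ≢[] [] ()
∷ʳ≢[] (_ ∷ _) ()

∷ʳ≢ : ∀ {A : Set} (xs : List A) {x} → xs ∷ʳ x ≢ xs
∷ʳ≢ [] ()
∷ʳ≢ (_ ∷ xs) eq = ∷ʳ≢ xs (∷-injectiveʳ eq)

∈-∷ʳ : ∀ {A : Set} (xs : List A) {x} → x ∈ xs ∷ʳ x
∈-∷ʳ xs = ∈-++⁺ʳ xs (here refl)

∷ʳ-cancel-↭ : ∀ {A : Set} {xs ys : List A} {z} → xs ∷ʳ z ↭ ys ∷ʳ z → xs ↭ ys
∷ʳ-cancel-↭ {xs = xs} {ys} p = begin
  xs      ≡⟨ ++-identityʳ xs ⟨
  xs ++ [] ↭⟨ drop-mid xs ys p ⟩
  ys ++ [] ≡⟨ ++-identityʳ ys ⟩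
  ys      ∎
  where open PermutationReasoning

Linked-∷ʳ⁺ : ∀ {A : Set} {R : A → A → Set} {xs y} →
             Linked R xs → All (λ x → R x y) xs → Linked R (xs ∷ʳ y)
Linked-∷ʳ⁺ [] [] = [-]
Linked-∷ʳ⁺ [-] (r ∷ []) = r ∷ [-]
Linked-∷ʳ⁺ (r ∷ l) (_ ∷ rs) = r ∷ Linked-∷ʳ⁺ l rs

Linked-++⁻ˡ : ∀ {A : Set} {R : A → A → Set} xs {ys} → Linked R (xs ++ ys) → Linked R xs
Linked-++⁻ˡ [] _ = []
Linked-++⁻ˡ (x ∷ []) _ = [-]
Linked-++⁻ˡ (x ∷ y ∷ xs) (r ∷ l) = r ∷ Linked-++⁻ˡ (y ∷ xs) l

Linked-<-max⇒∷ʳ : ∀ {c} → Linked _<_ c → m ∈ c → (∀ {x} → x ∈ c → x ≤ m) → ∃ λ c′ → c ≡ c′ ∷ʳ m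
Linked-<-max⇒∷ʳ {c = _ ∷ []} _ (here refl) _ = [] , refl
Linked-<-max⇒∷ʳ {c = _ ∷ _ ∷ _} (r ∷ _) (here refl) ≤m = ⊥-elim (<⇒≱ r (≤m (there (here refl))))
Linked-<-max⇒∷ʳ {c = x ∷ _ ∷ _} (_ ∷ l) (there p) ≤m
  with c′ , eq ← Linked-<-max⇒∷ʳ l p (≤m ∘ there) = x ∷ c′ , cong (x ∷_) eq

Unique-concatMap⁺ : ∀ {A B : Set} {f : A → List B} {xs} → Unique xs → (∀ x → Unique (f x)) →
                   (∀ {x y z} → x ∈ xs → y ∈ xs → z ∈ f x → z ∈ f y → x ≡ y) →
                   Unique (concatMap f xs)
Unique-concatMap⁺ [] _ _ = []
Unique-concatMap⁺ {f = f} {x ∷ xs} (x∉xs ∷ u) uf imagesMeet⇒≡ =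
  Unique.++⁺ (uf x) (Unique-concatMap⁺ u uf (λ p q → imagesMeet⇒≡ (there p) (there q))) disjoint
  where
  disjoint : ∀ {z} → ¬ (z ∈ f x × z ∈ concatMap f xs)
  disjoint (z∈fx , z∈rest) with y , y∈xs , z∈fy ← find (∈-concatMap⁻ f {xs = xs} z∈rest) =
    All.lookup x∉xs y∈xs (imagesMeet⇒≡ (here refl) (there y∈xs) z∈fx z∈fy)

NonEmptyBlocks : Blocks → Set
NonEmptyBlocks = All (_≢ [])

SortedBlocks : Blocks → Set
SortedBlocks = All (Linked _<_)

OrderedByMinimum : Blocks → Set
OrderedByMinimum = Linked firstLt

-- The inverse of deleting m from σ.  Adding m to an empty block is excluded, so
-- that the inverse also preserves non-emptiness of the blocks.
data Extension (m : ℕ) : Blocks → Blocks → Set where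
  newBlock  : Extension m [] ([ m ] ∷ [])
  intoBlock : ∀ {x b bs} → Extension m ((x ∷ b) ∷ bs) (((x ∷ b) ∷ʳ m) ∷ bs)
  skip      : ∀ {b bs σ} → Extension m bs σ → Extension m (b ∷ bs) (b ∷ σ)

extension-newBlock : ∀ τ → Extension m τ (τ ∷ʳ [ m ])
extension-newBlock [] = newBlock
extension-newBlock (b ∷ τ) = skip (extension-newBlock τ)

∈-addToOneBlock⇒extension : NonEmptyBlocks τ → σ ∈ addToOneBlock m τ → Extension m τ σ
∈-addToOneBlock⇒extension {τ = [] ∷ _} (b≢[] ∷ _) _ = ⊥-elim (b≢[] refl)
∈-addToOneBlock⇒extension {τ = (_ ∷ _) ∷ _} _ (here refl) = intoBlock
∈-addToOneBlock⇒extension {τ = b ∷ _} (_ ∷ ne) (there p)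
  with σ , σ∈ , refl ← ∈-map⁻ (b ∷_) p = skip (∈-addToOneBlock⇒extension ne σ∈)

extension⇒newBlock⊎∈addToOneBlock : Extension m τ σ → σ ≡ τ ∷ʳ [ m ] ⊎ σ ∈ addToOneBlock m τ
extension⇒newBlock⊎∈addToOneBlock newBlock = inj₁ refl
extension⇒newBlock⊎∈addToOneBlock intoBlock = inj₂ (here refl)
extension⇒newBlock⊎∈addToOneBlock (skip {b = b} e) with extension⇒newBlock⊎∈addToOneBlock e
... | inj₁ refl = inj₁ refl
... | inj₂ σ∈ = inj₂ (there (∈-map⁺ (b ∷_) σ∈))

newBlock∉addToOneBlock : ∀ τ → τ ∷ʳ [ m ] ∉ addToOneBlock m τ
newBlock∉addToOneBlock (b ∷ τ) (here eq) = ∷ʳ≢ b (sym (∷-injectiveˡ eq))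
newBlock∉addToOneBlock (b ∷ τ) (there p) with σ , σ∈ , eq ← ∈-map⁻ (b ∷_) p =
  newBlock∉addToOneBlock τ (subst (_∈ addToOneBlock _ τ) (sym (∷-injectiveʳ eq)) σ∈)

addToOneBlock-unique : ∀ m τ → Unique (addToOneBlock m τ)
addToOneBlock-unique m [] = []
addToOneBlock-unique m (b ∷ bs) =
  All.tabulate head≢ ∷ Unique.map⁺ ∷-injectiveʳ (addToOneBlock-unique m bs)
  where
  head≢ : σ ∈ map (b ∷_) (addToOneBlock m bs) → (b ∷ʳ m) ∷ bs ≢ σ
  head≢ p eq with _ , _ , refl ← ∈-map⁻ (b ∷_) p = ∷ʳ≢ b (∷-injectiveˡ eq)

-- Since m occurs in neither τ nor τ′, the block of σ containing m locates the
-- extension step, and removing m recovers the common origin.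
extension-injective : m ∉ concat τ → m ∉ concat τ′ →
                      Extension m τ σ → Extension m τ′ σ′ → σ ≡ σ′ → τ ≡ τ′
extension-injective _ _ newBlock newBlock _ = refl
extension-injective _ _ newBlock (intoBlock {b = b}) eq =
  ⊥-elim (∷ʳ≢[] b (sym (∷-injectiveʳ (∷-injectiveˡ eq))))
extension-injective _ m∉ newBlock (skip _) eq =
  ⊥-elim (m∉ (∈-++⁺ˡ (subst (_ ∈_) (∷-injectiveˡ eq) (here refl))))
extension-injective _ _ (intoBlock {b = b}) newBlock eq =
  ⊥-elim (∷ʳ≢[] b (∷-injectiveʳ (∷-injectiveˡ eq)))
extension-injective _ _ (intoBlock {x = x} {b}) (intoBlock {x = x′} {b′}) eq =
  cong₂ _∷_ (∷ʳ-injectiveˡ (x ∷ b) (x′ ∷ b′) (∷-injectiveˡ eq)) (∷-injectiveʳ eq)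
extension-injective _ m∉ (intoBlock {x = x} {b}) (skip _) eq =
  ⊥-elim (m∉ (∈-++⁺ˡ (subst (_ ∈_) (∷-injectiveˡ eq) (∈-∷ʳ (x ∷ b)))))
extension-injective m∉ _ (skip _) newBlock eq =
  ⊥-elim (m∉ (∈-++⁺ˡ (subst (_ ∈_) (sym (∷-injectiveˡ eq)) (here refl))))
extension-injective m∉ _ (skip _) (intoBlock {x = x} {b}) eq =
  ⊥-elim (m∉ (∈-++⁺ˡ (subst (_ ∈_) (sym (∷-injectiveˡ eq)) (∈-∷ʳ (x ∷ b)))))
extension-injective m∉ m∉′ (skip {b = b} e) (skip {b = b′} e′) eq =
  cong₂ _∷_ (∷-injectiveˡ eq)
    (extension-injective (m∉ ∘ ∈-++⁺ʳ b) (m∉′ ∘ ∈-++⁺ʳ b′) e e′ (∷-injectiveʳ eq))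

extension-concat : Extension m τ σ → concat σ ↭ concat τ ∷ʳ m
extension-concat newBlock = ↭-reflexive refl
extension-concat {m} (intoBlock {x = x} {b} {bs}) = begin
  ((x ∷ b) ++ [ m ]) ++ concat bs  ≡⟨ ++-assoc (x ∷ b) [ m ] (concat bs) ⟩
  (x ∷ b) ++ [ m ] ++ concat bs    ↭⟨ ++⁺ˡ (x ∷ b) (++-comm [ m ] (concat bs)) ⟩
  (x ∷ b) ++ concat bs ++ [ m ]    ≡⟨ ++-assoc (x ∷ b) (concat bs) [ m ] ⟨
  ((x ∷ b) ++ concat bs) ++ [ m ]  ∎
  where open PermutationReasoning
extension-concat {m} (skip {b = b} {bs} {σ} e) = begin
  b ++ concat σ          ↭⟨ ++⁺ˡ b (extension-concat e) ⟩
  b ++ concat bs ∷ʳ m    ≡⟨ ++-assoc b (concat bs) [ m ] ⟨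
  (b ++ concat bs) ∷ʳ m  ∎
  where open PermutationReasoning

extension-nonEmpty : Extension m τ σ → NonEmptyBlocks τ → NonEmptyBlocks σ
extension-nonEmpty newBlock [] = (λ ()) ∷ []
extension-nonEmpty intoBlock (_ ∷ ne) = (λ ()) ∷ ne
extension-nonEmpty (skip e) (b≢[] ∷ ne) = b≢[] ∷ extension-nonEmpty e ne

extension-nonEmpty⁻ : Extension m τ σ → NonEmptyBlocks σ → NonEmptyBlocks τ
extension-nonEmpty⁻ newBlock _ = []
extension-nonEmpty⁻ intoBlock (_ ∷ ne) = (λ ()) ∷ ne
extension-nonEmpty⁻ (skip e) (b≢[] ∷ ne) = b≢[] ∷ extension-nonEmpty⁻ e ne

extension-sorted : (∀ {x} → x ∈ concat τ → x < m) →
                   Extension m τ σ → SortedBlocks τ → SortedBlocks σ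
extension-sorted _ newBlock [] = [-] ∷ []
extension-sorted <m intoBlock (l ∷ ls) = Linked-∷ʳ⁺ l (All.tabulate (<m ∘ ∈-++⁺ˡ)) ∷ ls
extension-sorted <m (skip {b = b} e) (l ∷ ls) = l ∷ extension-sorted (<m ∘ ∈-++⁺ʳ b) e ls

extension-sorted⁻ : Extension m τ σ → SortedBlocks σ → SortedBlocks τ
extension-sorted⁻ newBlock _ = []
extension-sorted⁻ (intoBlock {x = x} {b}) (l ∷ ls) = Linked-++⁻ˡ (x ∷ b) l ∷ ls
extension-sorted⁻ (skip e) (l ∷ ls) = l ∷ extension-sorted⁻ e ls

extension-ordered : NonEmptyBlocks τ → (∀ {x} → x ∈ concat τ → x < m) →
                    Extension m τ σ → OrderedByMinimum τ → OrderedByMinimum σ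
extension-ordered _ _ newBlock [] = [-]
extension-ordered _ _ (intoBlock {bs = []}) [-] = [-]
extension-ordered _ _ (intoBlock {bs = (_ ∷ _) ∷ _}) (r ∷ l) = r ∷ l
extension-ordered (b≢[] ∷ _) _ (skip {b = []} _) _ = ⊥-elim (b≢[] refl)
extension-ordered _ <m (skip {b = _ ∷ _} newBlock) [-] = <m (here refl) ∷ [-]
extension-ordered (_ ∷ ne) <m (skip {b = b@(_ ∷ _)} e@intoBlock) (r ∷ l) =
  r ∷ extension-ordered ne (<m ∘ ∈-++⁺ʳ b) e l
extension-ordered (_ ∷ ne) <m (skip {b = b@(_ ∷ _)} e@(skip _)) (r ∷ l) =
  r ∷ extension-ordered ne (<m ∘ ∈-++⁺ʳ b) e l

extension-ordered⁻ : Extension m τ σ → OrderedByMinimum σ → OrderedByMinimum τ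
extension-ordered⁻ newBlock _ = []
extension-ordered⁻ (intoBlock {bs = []}) _ = [-]
extension-ordered⁻ (intoBlock {bs = (_ ∷ _) ∷ _}) (r ∷ l) = r ∷ l
extension-ordered⁻ (skip newBlock) _ = [-]
extension-ordered⁻ (skip {b = _ ∷ _} e@intoBlock) (r ∷ l) = r ∷ extension-ordered⁻ e l
extension-ordered⁻ (skip {b = _ ∷ _} e@(skip _)) (r ∷ l) = r ∷ extension-ordered⁻ e l

extension-of-max : ∀ σ → SortedBlocks σ → OrderedByMinimum σ →
                   (∀ {x} → x ∈ concat σ → x ≤ m) → m ∈ concat σ → ∃ λ τ → Extension m τ σ
extension-of-max (c ∷ σ) (lc ∷ ls) ord ≤m m∈ with ∈-++⁻ c m∈
... | inj₁ m∈c with c′ , refl ← Linked-<-max⇒∷ʳ lc m∈c (≤m ∘ ∈-++⁺ˡ) =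
  atHead c′ σ ord (≤m ∘ ∈-++⁺ʳ (c′ ∷ʳ _))
  where
  atHead : ∀ c′ σ → OrderedByMinimum ((c′ ∷ʳ m) ∷ σ) → (∀ {x} → x ∈ concat σ → x ≤ m) →
           ∃ λ τ → Extension m τ ((c′ ∷ʳ m) ∷ σ)
  atHead [] [] _ _ = [] , newBlock
  atHead [] ((_ ∷ _) ∷ _) (r ∷ _) ≤m = ⊥-elim (<⇒≱ r (≤m (here refl)))
  atHead (x ∷ c′) σ _ _ = (x ∷ c′) ∷ σ , intoBlock
... | inj₂ m∈σ with τ , e ← extension-of-max σ ls (Linked.tail ord) (≤m ∘ ∈-++⁺ʳ c) m∈σ =
  c ∷ τ , skip e

map-suc-upTo-suc : ∀ n → map suc (upTo (suc n)) ≡ map suc (upTo n) ∷ʳ suc n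
map-suc-upTo-suc n = trans (cong (map suc) (sym (upTo-∷ʳ n))) (map-++ suc (upTo n) [ n ])

isSetPartition-≤ : IsSetPartition n τ → ∀ {x} → x ∈ concat τ → x ≤ n
isSetPartition-≤ (_ , _ , _ , perm) x∈
  with i , i∈ , refl ← ∈-map⁻ suc (∈-resp-↭ perm x∈) = ∈-upTo⁻ i∈

isSetPartition-∋ : IsSetPartition n τ → ∀ {i} → i < n → suc i ∈ concat τ
isSetPartition-∋ (_ , _ , _ , perm) i<n = ∈-resp-↭ (↭-sym perm) (∈-map⁺ suc (∈-upTo⁺ i<n))

isSetPartition-size : IsSetPartition n τ → size τ ≡ n
isSetPartition-size {n} (_ , _ , _ , perm) =
  trans (↭-length perm) (trans (length-map suc (upTo n)) (length-upTo n))

extension-isSetPartition : IsSetPartition n τ → Extension (suc n) τ σ → IsSetPartition (suc n) σ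
extension-isSetPartition {n} {τ} {σ} p@(ne , ls , ord , perm) e =
  extension-nonEmpty e ne , extension-sorted <m e ls , extension-ordered ne <m e ord , perm′
  where
  <m : ∀ {x} → x ∈ concat τ → x < suc n
  <m = s≤s ∘ isSetPartition-≤ p
  perm′ : concat σ ↭ map suc (upTo (suc n))
  perm′ = begin
    concat σ                  ↭⟨ extension-concat e ⟩
    concat τ ∷ʳ suc n         ↭⟨ ++⁺ʳ [ suc n ] perm ⟩
    map suc (upTo n) ∷ʳ suc n ≡⟨ map-suc-upTo-suc n ⟨
    map suc (upTo (suc n))    ∎
    where open PermutationReasoning

isSetPartition-restrict : IsSetPartition (suc n) σ →
                          ∃ λ τ → IsSetPartition n τ × Extension (suc n) τ σ
isSetPartition-restrict {n} {σ} p@(ne , ls , ord , perm)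
  with τ , e ← extension-of-max σ ls ord (isSetPartition-≤ p) (isSetPartition-∋ p (n<1+n n)) =
  τ , (extension-nonEmpty⁻ e ne , extension-sorted⁻ e ls , extension-ordered⁻ e ord , perm′) , e
  where
  open PermutationReasoning
  perm′ : concat τ ↭ map suc (upTo n)
  perm′ = ∷ʳ-cancel-↭ (begin
    concat τ ∷ʳ suc n         ↭⟨ extension-concat e ⟨
    concat σ                  ↭⟨ perm ⟩
    map suc (upTo (suc n))    ≡⟨ map-suc-upTo-suc n ⟩
    map suc (upTo n) ∷ʳ suc n ∎)

partitions : ℕ → List Blocks
partitions zero = [ [] ]
partitions (suc n) =
  map (_∷ʳ [ suc n ]) (partitions n) ++ concatMap (addToOneBlock (suc n)) (partitions n)

partitions-sound : ∀ n → σ ∈ partitions n → IsSetPartition n σ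
partitions-sound zero (here refl) = [] , [] , [] , ↭-reflexive refl
partitions-sound (suc n) σ∈ with ∈-++⁻ (map (_∷ʳ [ suc n ]) (partitions n)) σ∈
... | inj₁ σ∈new with τ , τ∈ , refl ← ∈-map⁻ (_∷ʳ [ suc n ]) σ∈new =
  extension-isSetPartition (partitions-sound n τ∈) (extension-newBlock τ)
... | inj₂ σ∈add
  with τ , τ∈ , σ∈τ+ ← find (∈-concatMap⁻ (addToOneBlock (suc n)) {xs = partitions n} σ∈add) =
  let p = partitions-sound n τ∈ in extension-isSetPartition p (∈-addToOneBlock⇒extension (proj₁ p) σ∈τ+)

partitions-complete : ∀ n {σ} → IsSetPartition n σ → σ ∈ partitions n
partitions-complete zero {[]} _ = here refl
partitions-complete zero {b ∷ σ} (b≢[] ∷ _ , _ , _ , perm) =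
  ⊥-elim (b≢[] (++-conicalˡ b (concat σ) (↭-empty-inv perm)))
partitions-complete (suc n) p
  with τ , q , e ← isSetPartition-restrict p
  with extension⇒newBlock⊎∈addToOneBlock e
... | inj₁ refl = ∈-++⁺ˡ (∈-map⁺ (_∷ʳ [ suc n ]) (partitions-complete n q))
... | inj₂ σ∈τ+ = ∈-++⁺ʳ (map (_∷ʳ [ suc n ]) (partitions n))
  (∈-concatMap⁺ (addToOneBlock (suc n)) {xs = partitions n} (lose (partitions-complete n q) σ∈τ+))

partitions-unique : ∀ n → Unique (partitions n)
partitions-unique zero = [] ∷ []
partitions-unique (suc n) =
  Unique.++⁺ (Unique.map⁺ (∷ʳ-injectiveˡ _ _) (partitions-unique n))
    (Unique-concatMap⁺ (partitions-unique n) (addToOneBlock-unique (suc n)) sameOrigin)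
    disjoint
  where
  P = partitions n
  m∉ : τ ∈ P → suc n ∉ concat τ
  m∉ τ∈ = 1+n≰n ∘ isSetPartition-≤ (partitions-sound n τ∈)
  extension : τ ∈ P → σ ∈ addToOneBlock (suc n) τ → Extension (suc n) τ σ
  extension τ∈ = ∈-addToOneBlock⇒extension (proj₁ (partitions-sound n τ∈))
  sameOrigin : τ ∈ P → τ′ ∈ P → σ ∈ addToOneBlock (suc n) τ → σ ∈ addToOneBlock (suc n) τ′ → τ ≡ τ′
  sameOrigin τ∈ τ′∈ σ∈ σ∈′ =
    extension-injective (m∉ τ∈) (m∉ τ′∈) (extension τ∈ σ∈) (extension τ′∈ σ∈′) refl
  disjoint : ¬ (σ ∈ map (_∷ʳ [ suc n ]) P × σ ∈ concatMap (addToOneBlock (suc n)) P)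
  disjoint (σ∈new , σ∈add)
    with τ , τ∈ , refl ← ∈-map⁻ (_∷ʳ [ suc n ]) σ∈new
       | τ′ , τ′∈ , σ∈τ′+ ← find (∈-concatMap⁻ (addToOneBlock (suc n)) {xs = P} σ∈add)
    with refl ← extension-injective (m∉ τ∈) (m∉ τ′∈) (extension-newBlock τ) (extension τ′∈ σ∈τ′+) refl =
    newBlock∉addToOneBlock τ σ∈τ′+

sumΦ : List Blocks → WSym
sumΦ = map (λ π → (+ 1 , π))

coeff-sumΦ-∉ : ∀ πs → σ ∉ πs → coeff (sumΦ πs) σ ≡ + 0
coeff-sumΦ-∉ [] _ = refl
coeff-sumΦ-∉ {σ} (π ∷ πs) σ∉ with ≡-dec (≡-dec ℕ._≟_) π σ
... | yes π≡σ = ⊥-elim (σ∉ (here (sym π≡σ)))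
... | no _ = coeff-sumΦ-∉ πs (σ∉ ∘ there)

coeff-sumΦ-∈ : ∀ {πs} → Unique πs → σ ∈ πs → coeff (sumΦ πs) σ ≡ + 1
coeff-sumΦ-∈ {σ} {π ∷ πs} (π∉πs ∷ u) σ∈ with ≡-dec (≡-dec ℕ._≟_) π σ | σ∈
... | yes refl | _ = cong ((+ 1) +ℤ_) (coeff-sumΦ-∉ πs (λ σ∈πs → All.lookup π∉πs σ∈πs refl))
... | no π≢σ | here σ≡π = ⊥-elim (π≢σ (sym σ≡π))
... | no _ | there σ∈πs = coeff-sumΦ-∈ u σ∈πs

sumΦ-·Φ₁ : ∀ πs → sumΦ πs · Φ₁ ≡ sumΦ (map (λ π → π ∷ʳ [ size π + 1 ]) πs)
sumΦ-·Φ₁ [] = refl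
sumΦ-·Φ₁ (π ∷ πs) = cong (_ ∷_) (sumΦ-·Φ₁ πs)

∂-sumΦ : ∀ πs → ∂ (sumΦ πs) ≡ sumΦ (concatMap (λ π → addToOneBlock (suc (size π)) π) πs)
∂-sumΦ [] = refl
∂-sumΦ (π ∷ πs) =
  trans (cong (sumΦ (addToOneBlock _ π) ++_) (∂-sumΦ πs)) (sym (map-++ _ (addToOneBlock _ π) _))

𝔄≡sumΦ-partitions : ∀ n → 𝔄 n ≡ sumΦ (partitions n)
𝔄≡sumΦ-partitions zero = refl
𝔄≡sumΦ-partitions (suc n) = begin
  𝔄 n · Φ₁ ++ ∂ (𝔄 n)
    ≡⟨ cong (λ x → x · Φ₁ ++ ∂ x) (𝔄≡sumΦ-partitions n) ⟩
  sumΦ P · Φ₁ ++ ∂ (sumΦ P)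
    ≡⟨ cong₂ _++_ (sumΦ-·Φ₁ P) (∂-sumΦ P) ⟩
  sumΦ (map (λ π → π ∷ʳ [ size π + 1 ]) P) ++ sumΦ (concatMap (λ π → addToOneBlock (suc (size π)) π) P)
    ≡⟨ cong₂ (λ xs xss → sumΦ xs ++ sumΦ (concat xss)) newBlocks addedBlocks ⟩
  sumΦ (map (_∷ʳ [ suc n ]) P) ++ sumΦ (concatMap (addToOneBlock (suc n)) P)
    ≡⟨ map-++ _ (map (_∷ʳ [ suc n ]) P) _ ⟨
  sumΦ (partitions (suc n)) ∎
  where
  open ≡-Reasoning
  P = partitions n
  sizes : All (λ π → size π ≡ n) P
  sizes = All.tabulate (isSetPartition-size ∘ partitions-sound n)
  newBlocks : map (λ π → π ∷ʳ [ size π + 1 ]) P ≡ map (_∷ʳ [ suc n ]) P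
  newBlocks = map-cong-local (All.map newBlock-size sizes)
    where
    newBlock-size : ∀ {π} → size π ≡ n → π ∷ʳ [ size π + 1 ] ≡ π ∷ʳ [ suc n ]
    newBlock-size {π} refl = cong (λ k → π ∷ʳ [ k ]) (+-comm (size π) 1)
  addedBlocks : map (λ π → addToOneBlock (suc (size π)) π) P ≡ map (addToOneBlock (suc n)) P
  addedBlocks = map-cong-local (All.map (cong (λ k → addToOneBlock (suc k) _)) sizes)

mainTheorem8 : (n : ℕ) (σ : Blocks) →
    (IsSetPartition n σ → coeff (𝔄 n) σ ≡ + 1) × (¬ IsSetPartition n σ → coeff (𝔄 n) σ ≡ + 0)
mainTheorem8 n σ rewrite 𝔄≡sumΦ-partitions n =
  (λ p → coeff-sumΦ-∈ (partitions-unique n) (partitions-complete n p)) ,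
  (λ ¬p → coeff-sumΦ-∉ (partitions n) (¬p ∘ partitions-sound n))
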